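{- Let $G$ be a finite group, let $H$ be a nontrivial subgroup of $G$ whose order $|H|$ is a prime, and let $x\in G$ with $HxH\neq Hx^{ -1}H$. Then there exist $|H|$ pairwise disjoint inverse-closed right transversals of $H$ in $HxH\cup Hx^{ -1}H$. In particular, for any integer $0\leqslant b\leqslant |H|$, there exist $b$ pairwise disjoint right transversals of $H$ in $HxH\cup Hx^{ -1}H$ whose union is inverse-closed.
   Context: $HxH=\{hxh':h,h'\in H\}$ is a double coset; it is a union of right cosets of $H$. For a set $K$ of elements of $G$ that is a union of right cosets of $H$, a right transversal of $H$ in $K$ is a subset of $G$ formed by taking exactly one element from each right coset of $H$ contained in $K$. A subset $R$ is inverse-closed if $R^{ -1}=R$. -}

module Defs where

open import Data.Nat using (ℕ)
open import Data.Fin using (Fin)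
open import Data.Fin.Subset using (Subset; _∈_; _∉_; ∣_∣)
open import Data.Product using (Σ; ∃; _×_; _,_)
open import Data.Sum using (_⊎_)
open import Relation.Binary.PropositionalEquality using (_≡_; _≢_)
open import Relation.Nullary using (¬_)
open import Function.Bundles using (_⇔_)
open import Algebra.Structures using (IsGroup)

-- A finite group, presented on the carrier Fin n (every finite group is
-- isomorphic to one of this form), with propositional equality.
record FiniteGroup : Set where
  infixl 7 _∙_
  infix 8 _⁻¹
  field
    n       : ℕ
    _∙_     : Fin n → Fin n → Fin n
    ε       : Fin n
    _⁻¹     : Fin n → Fin n
    isGroup : IsGroup _≡_ _∙_ ε _⁻¹

module _ (G : FiniteGroup) where
  open FiniteGroup G

  record IsSubgroup (H : Subset n) : Set where
    field
      ε∈    : ε ∈ H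
      ∙-closed : ∀ {a b} → a ∈ H → b ∈ H → a ∙ b ∈ H
      ⁻¹-closed : ∀ {a} → a ∈ H → a ⁻¹ ∈ H

  InDoubleCoset : Subset n → Fin n → Fin n → Set
  InDoubleCoset H x g = ∃ λ h → ∃ λ h' → h ∈ H × h' ∈ H × g ≡ h ∙ x ∙ h'

  InRightCoset : Subset n → Fin n → Fin n → Set
  InRightCoset H y g = ∃ λ h → h ∈ H × g ≡ h ∙ y

  record IsRightTransversal (H : Subset n) (K : Fin n → Set) (T : Subset n) : Set where
    field
      ⊆K     : ∀ {t} → t ∈ T → K t
      exists : ∀ y → K y → ∃ λ t → t ∈ T × InRightCoset H y t
      unique : ∀ y {t t'} → t ∈ T → t' ∈ T →
               InRightCoset H y t → InRightCoset H y t' → t ≡ t'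

  InverseClosed : Subset n → Set
  InverseClosed T = ∀ {t} → t ∈ T → t ⁻¹ ∈ T

  Disjoint : Subset n → Subset n → Set
  Disjoint S T = ∀ {g} → g ∈ S → g ∉ T

  PairwiseDisjoint : ∀ {m} → (Fin m → Subset n) → Set
  PairwiseDisjoint {m} T = ∀ (i j : Fin m) → i ≢ j → Disjoint (T i) (T j)

  UnionInverseClosed : ∀ {m} → (Fin m → Subset n) → Set
  UnionInverseClosed {m} T = ∀ (i : Fin m) {g} → g ∈ T i → ∃ λ j → g ⁻¹ ∈ T j

-- If |H| = p is prime, H ∩ xHx⁻¹ is a subgroup of H, so by Lagrange it is
-- trivial or all of H.  In the first case every element of HxH factors uniquely
-- as h x k, its right coset being fixed by k and its left coset by h; hence for
-- each a ∈ H the "diagonal" V_a = {a k x k : k ∈ H} meets every right and every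
-- left coset in HxH exactly once, i.e. V_a is a right transversal of HxH and
-- V_a⁻¹ one of Hx⁻¹H, and distinct a give disjoint V_a.  In the second case
-- HxH = Hx and V_a = {a x} does the same job.  Since HxH ≠ Hx⁻¹H these double
-- cosets are disjoint, so the sets V_a ∪ V_a⁻¹ (a ∈ H) are |H| pairwise
-- disjoint inverse-closed transversals of HxH ∪ Hx⁻¹H; any b of them give the
-- second claim.

module Submission where

open import Defs
open import Data.Nat using (ℕ; _≤_)
open import Data.Nat.Primality using (Prime)
open import Data.Fin using (Fin)
open import Data.Fin.Subset using (Subset; _∈_; ∣_∣)
open import Data.Product using (Σ; ∃; _×_; _,_)
open import Data.Sum using (_⊎_)
open import Relation.Nullary using (¬_)
open import Function.Bundles using (_⇔_)

open import Level using (0ℓ)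
open import Algebra.Bundles using (Group)
import Algebra.Properties.Group as GroupProperties
open import Data.Nat using (zero; suc; _+_; _<_; z≤n; s≤s)
import Data.Nat.Properties as ℕ
open import Data.Nat.Divisibility using (_∣_; ∣m∣n⇒∣m+n; _∣0; ∣-reflexive)
open import Data.Nat.Primality using (prime⇒irreducible)
open import Data.Fin using (zero; suc; _≟_; inject≤)
import Data.Fin.Properties as Fin
open import Data.Fin.Subset using (inside; outside; _∉_; _─_; _-_; _∪_; _⊆_; _⊂_; ⁅_⁆)
import Data.Fin.Subset.Properties as Subset
open import Data.Fin.Subset.Induction using (⊂-wellFounded; Acc; acc)
open import Data.Product using (proj₁; proj₂)
open import Data.Sum as Sum using (inj₁; inj₂)
open import Data.Empty using (⊥-elim)
open import Data.Vec.Base using (_∷_; []; here; there)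
open import Relation.Nullary using (yes; no; ¬?; _×-dec_; decidable-stable)
open import Relation.Unary using (Decidable)
open import Function.Bundles using (mk⇔; Equivalence)
open import Relation.Binary.PropositionalEquality

subset : ∀ {n} {P : Fin n → Set} → Decidable P → Subset n
subset {zero}  P? = []
subset {suc n} P? with P? zero
... | yes _ = inside  ∷ subset (λ i → P? (suc i))
... | no  _ = outside ∷ subset (λ i → P? (suc i))

∈-subset⁺ : ∀ {n} {P : Fin n → Set} (P? : Decidable P) {x} → P x → x ∈ subset P?
∈-subset⁺ {suc n} P? {zero} px with P? zero
... | yes _  = here
... | no ¬px = ⊥-elim (¬px px)
∈-subset⁺ {suc n} P? {suc x} px with P? zero
... | yes _ = there (∈-subset⁺ (λ i → P? (suc i)) px)
... | no  _ = there (∈-subset⁺ (λ i → P? (suc i)) px)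

∈-subset⁻ : ∀ {n} {P : Fin n → Set} (P? : Decidable P) {x} → x ∈ subset P? → P x
∈-subset⁻ {suc n} P? {zero} x∈ with P? zero
∈-subset⁻ {suc n} P? {zero} x∈       | yes px = px
∈-subset⁻ {suc n} P? {zero} ()       | no  _
∈-subset⁻ {suc n} P? {suc x} x∈ with P? zero
∈-subset⁻ {suc n} P? {suc x} (there x∈) | yes _ = ∈-subset⁻ (λ i → P? (suc i)) x∈
∈-subset⁻ {suc n} P? {suc x} (there x∈) | no  _ = ∈-subset⁻ (λ i → P? (suc i)) x∈

enumerate : ∀ {n} (p : Subset n) → Fin ∣ p ∣ → Fin n
enumerate (inside  ∷ p) zero    = zero
enumerate (inside  ∷ p) (suc i) = suc (enumerate p i)
enumerate (outside ∷ p) i       = suc (enumerate p i)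

enumerate-∈ : ∀ {n} (p : Subset n) i → enumerate p i ∈ p
enumerate-∈ (inside  ∷ p) zero    = here
enumerate-∈ (inside  ∷ p) (suc i) = there (enumerate-∈ p i)
enumerate-∈ (outside ∷ p) i       = there (enumerate-∈ p i)

enumerate-injective : ∀ {n} (p : Subset n) {i j} → enumerate p i ≡ enumerate p j → i ≡ j
enumerate-injective (inside  ∷ p) {zero}  {zero}  _  = refl
enumerate-injective (inside  ∷ p) {suc i} {suc j} eq = cong suc (enumerate-injective p (Fin.suc-injective eq))
enumerate-injective (outside ∷ p)                 eq = enumerate-injective p (Fin.suc-injective eq)

enumerate-surjective : ∀ {n} (p : Subset n) {x} → x ∈ p → ∃ λ i → enumerate p i ≡ x
enumerate-surjective (inside  ∷ p) here        = zero , refl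
enumerate-surjective (inside  ∷ p) (there x∈p) with enumerate-surjective p x∈p
... | i , eq = suc i , cong suc eq
enumerate-surjective (outside ∷ p) (there x∈p) with enumerate-surjective p x∈p
... | i , eq = i , cong suc eq

injectiveOn⇒∣p∣≤∣q∣ : ∀ {n} (p q : Subset n) (f : Fin n → Fin n) →
  (∀ {x} → x ∈ p → f x ∈ q) →
  (∀ {x y} → x ∈ p → y ∈ p → f x ≡ f y → x ≡ y) → ∣ p ∣ ≤ ∣ q ∣
injectiveOn⇒∣p∣≤∣q∣ p q f f∈q f-inj = Fin.injective⇒≤ index-injective
  where
  index : Fin ∣ p ∣ → Fin ∣ q ∣
  index i = proj₁ (enumerate-surjective q (f∈q (enumerate-∈ p i)))

  enumerate-index : ∀ i → enumerate q (index i) ≡ f (enumerate p i)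
  enumerate-index i = proj₂ (enumerate-surjective q (f∈q (enumerate-∈ p i)))

  index-injective : ∀ {i j} → index i ≡ index j → i ≡ j
  index-injective {i} {j} eq = enumerate-injective p (f-inj (enumerate-∈ p i) (enumerate-∈ p j)
    (trans (sym (enumerate-index i)) (trans (cong (enumerate q) eq) (enumerate-index j))))

x∈p─q⇒x∉q : ∀ {n} (p q : Subset n) {x} → x ∈ p ─ q → x ∉ q
x∈p─q⇒x∉q (_ ∷ p) (inside ∷ q) {zero}  ()        here
x∈p─q⇒x∉q (_ ∷ p) (_      ∷ q) {suc x} (there x∈) (there x∈q) = x∈p─q⇒x∉q p q x∈ x∈q

∣p∣≡∣p─q∣+∣q∣ : ∀ {n} (p q : Subset n) → q ⊆ p → ∣ p ∣ ≡ ∣ p ─ q ∣ + ∣ q ∣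
∣p∣≡∣p─q∣+∣q∣ []            []            _   = refl
∣p∣≡∣p─q∣+∣q∣ (inside  ∷ p) (inside  ∷ q) q⊆p =
  trans (cong suc (∣p∣≡∣p─q∣+∣q∣ p q (Subset.drop-∷-⊆ q⊆p))) (sym (ℕ.+-suc _ _))
∣p∣≡∣p─q∣+∣q∣ (outside ∷ p) (inside  ∷ q) q⊆p with q⊆p here
... | ()
∣p∣≡∣p─q∣+∣q∣ (inside  ∷ p) (outside ∷ q) q⊆p = cong suc (∣p∣≡∣p─q∣+∣q∣ p q (Subset.drop-∷-⊆ q⊆p))
∣p∣≡∣p─q∣+∣q∣ (outside ∷ p) (outside ∷ q) q⊆p = ∣p∣≡∣p─q∣+∣q∣ p q (Subset.drop-∷-⊆ q⊆p)

x∈p∧y∈p∧x≢y⇒2≤∣p∣ : ∀ {n} {p : Subset n} {x y} → x ∈ p → y ∈ p → x ≢ y → 2 ≤ ∣ p ∣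
x∈p∧y∈p∧x≢y⇒2≤∣p∣ {p = p} {y = y} x∈p y∈p x≢y = ℕ.≤-trans (s≤s 0<∣p-y∣) (Subset.x∈p⇒∣p-x∣<∣p∣ y∈p)
  where
  0<∣p-y∣ : 0 < ∣ p - y ∣
  0<∣p-y∣ = ℕ.≤-<-trans z≤n (Subset.x∈p⇒∣p-x∣<∣p∣ (Subset.x∈p∧x≢y⇒x∈p-y x∈p x≢y))

module FiniteGroupTheory (G : FiniteGroup) where
  open FiniteGroup G

  group : Group 0ℓ 0ℓ
  group = record { isGroup = isGroup }

  open Group group public using (assoc; identityˡ; identityʳ; inverseˡ; inverseʳ; monoid)
  open GroupProperties group public
    using (⁻¹-involutive; ⁻¹-anti-homo-∙; ⁻¹-injective; ∙-cancelˡ; ∙-cancelʳ;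
           \\-leftDividesˡ; \\-leftDividesʳ; //-rightDividesˡ; //-rightDividesʳ)
  open import Algebra.Solver.Monoid monoid using (solve; _⊜_; _⊕_)
  open ≡-Reasoning

  infixl 8 _·_

  _·_ : Fin n → Subset n → Subset n
  g · p = subset (λ h → (g ⁻¹ ∙ h) Subset.∈? p)

  ∣g·p∣≡∣p∣ : ∀ g p → ∣ g · p ∣ ≡ ∣ p ∣
  ∣g·p∣≡∣p∣ g p = ℕ.≤-antisym
    (injectiveOn⇒∣p∣≤∣q∣ (g · p) p (g ⁻¹ ∙_) (∈-subset⁻ _) (λ _ _ → ∙-cancelˡ (g ⁻¹) _ _))
    (injectiveOn⇒∣p∣≤∣q∣ p (g · p) (g ∙_)
      (λ {h} h∈p → ∈-subset⁺ _ (subst (_∈ p) (sym (\\-leftDividesʳ g h)) h∈p))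
      (λ _ _ → ∙-cancelˡ g _ _))

  module _ {L : Subset n} (L-subgroup : IsSubgroup G L) where
    open IsSubgroup L-subgroup

    RightInvariant : Subset n → Set
    RightInvariant S = ∀ {s l} → s ∈ S → l ∈ L → s ∙ l ∈ S

    ∣L∣∣∣S∣ : ∀ S → RightInvariant S → ∣ L ∣ ∣ ∣ S ∣
    ∣L∣∣∣S∣ S = go S (⊂-wellFounded S)
      where
      go : ∀ S → Acc _⊂_ S → RightInvariant S → ∣ L ∣ ∣ ∣ S ∣
      go S (acc smaller) S-inv with Subset.nonempty? S
      ... | no S-empty rewrite Subset.Empty-unique S-empty | Subset.∣⊥∣≡0 n = _ ∣0
      ... | yes (s , s∈S) =
        subst (∣ L ∣ ∣_) (sym ∣S∣≡) (∣m∣n⇒∣m+n (go (S ─ s · L) (smaller rest⊂S) rest-inv)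
                                              (∣-reflexive (sym (∣g·p∣≡∣p∣ s L))))
        where
        sL⊆S : s · L ⊆ S
        sL⊆S {h} h∈sL = subst (_∈ S) (\\-leftDividesˡ s h) (S-inv s∈S (∈-subset⁻ _ h∈sL))

        ∣S∣≡ : ∣ S ∣ ≡ ∣ S ─ s · L ∣ + ∣ s · L ∣
        ∣S∣≡ = ∣p∣≡∣p─q∣+∣q∣ S (s · L) sL⊆S

        rest⊂S : S ─ s · L ⊂ S
        rest⊂S = Subset.p∩q≢∅⇒p─q⊂p S (s · L)
          (s , Subset.x∈p∩q⁺ (s∈S , ∈-subset⁺ _ (subst (_∈ L) (sym (inverseˡ s)) ε∈)))

        rest-inv : RightInvariant (S ─ s · L)
        rest-inv {g} {l} g∈rest l∈L = Subset.x∈p∧x∉q⇒x∈p─q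
          (S-inv (Subset.p─q⊆p S (s · L) g∈rest) l∈L)
          λ gl∈sL → x∈p─q⇒x∉q S (s · L) g∈rest (∈-subset⁺ _ (subst (_∈ L)
            (trans (cong (_∙ l ⁻¹) (sym (assoc _ _ _))) (//-rightDividesʳ l _))
            (∙-closed (∈-subset⁻ _ gl∈sL) (⁻¹-closed l∈L))))

  lagrange : ∀ {L H} → IsSubgroup G L → IsSubgroup G H → L ⊆ H → ∣ L ∣ ∣ ∣ H ∣
  lagrange L-subgroup H-subgroup L⊆H =
    ∣L∣∣∣S∣ L-subgroup _ (λ s∈H l∈L → IsSubgroup.∙-closed H-subgroup s∈H (L⊆H l∈L))

  nontrivial-subgroup-of-prime-order : ∀ {L H y} → IsSubgroup G L → IsSubgroup G H → Prime ∣ H ∣ →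
    L ⊆ H → y ∈ L → y ≢ ε → H ⊆ L
  nontrivial-subgroup-of-prime-order {L} {H} L-subgroup H-subgroup p L⊆H y∈L y≢ε {h} h∈H
    with h Subset.∈? L | prime⇒irreducible p (lagrange L-subgroup H-subgroup L⊆H)
  ... | yes h∈L | _ = h∈L
  ... | no  _   | inj₁ ∣L∣≡1 = ⊥-elim (ℕ.<-irrefl (sym ∣L∣≡1)
                                 (x∈p∧y∈p∧x≢y⇒2≤∣p∣ y∈L (IsSubgroup.ε∈ L-subgroup) y≢ε))
  ... | no  h∉L | inj₂ ∣L∣≡∣H∣ = ⊥-elim (ℕ.<-irrefl ∣L∣≡∣H∣ (Subset.p⊂q⇒∣p∣<∣q∣ (L⊆H , h , h∈H , h∉L)))

  ⁻¹-anti-homo-∙∙ : ∀ a z b → (a ∙ z ∙ b) ⁻¹ ≡ b ⁻¹ ∙ z ⁻¹ ∙ a ⁻¹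
  ⁻¹-anti-homo-∙∙ a z b = begin
    (a ∙ z ∙ b) ⁻¹          ≡⟨ ⁻¹-anti-homo-∙ (a ∙ z) b ⟩
    b ⁻¹ ∙ (a ∙ z) ⁻¹       ≡⟨ cong (b ⁻¹ ∙_) (⁻¹-anti-homo-∙ a z) ⟩
    b ⁻¹ ∙ (z ⁻¹ ∙ a ⁻¹)    ≡⟨ assoc _ _ _ ⟨
    b ⁻¹ ∙ z ⁻¹ ∙ a ⁻¹      ∎

  infixl 8 _^_

  _^_ : Fin n → Fin n → Fin n
  h ^ z = z ⁻¹ ∙ h ∙ z

  ^-∙ : ∀ a b z → (a ∙ b) ^ z ≡ a ^ z ∙ b ^ z
  ^-∙ a b z = begin
    z ⁻¹ ∙ (a ∙ b) ∙ z                ≡⟨ cong (λ u → z ⁻¹ ∙ (u ∙ b) ∙ z) (//-rightDividesʳ z a) ⟨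
    z ⁻¹ ∙ (a ∙ z ∙ z ⁻¹ ∙ b) ∙ z     ≡⟨ solve 4 (λ z⁻ a z b → (z⁻ ⊕ (((a ⊕ z) ⊕ z⁻) ⊕ b)) ⊕ z
                                                    ⊜ ((z⁻ ⊕ a) ⊕ z) ⊕ ((z⁻ ⊕ b) ⊕ z)) refl (z ⁻¹) a z b ⟩
    z ⁻¹ ∙ a ∙ z ∙ (z ⁻¹ ∙ b ∙ z)     ∎

  ^-ε : ∀ z → ε ^ z ≡ ε
  ^-ε z = trans (cong (_∙ z) (identityʳ (z ⁻¹))) (inverseˡ z)

  ^-⁻¹ : ∀ a z → (a ⁻¹) ^ z ≡ (a ^ z) ⁻¹
  ^-⁻¹ a z = GroupProperties.inverseʳ-unique group (a ^ z) ((a ⁻¹) ^ z)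
    (trans (sym (^-∙ a (a ⁻¹) z)) (trans (cong (_^ z) (inverseʳ a)) (^-ε z)))

  ^-⁻¹-cancel : ∀ a z → (a ^ (z ⁻¹)) ^ z ≡ a
  ^-⁻¹-cancel a z = begin
    z ⁻¹ ∙ (z ⁻¹ ⁻¹ ∙ a ∙ z ⁻¹) ∙ z   ≡⟨ cong (λ u → z ⁻¹ ∙ (u ∙ a ∙ z ⁻¹) ∙ z) (⁻¹-involutive z) ⟩
    z ⁻¹ ∙ (z ∙ a ∙ z ⁻¹) ∙ z         ≡⟨ solve 4 (λ z⁻ z a z⁻' → (z⁻ ⊕ ((z ⊕ a) ⊕ z⁻')) ⊕ z
                                                    ⊜ (z⁻ ⊕ (z ⊕ (a ⊕ (z⁻' ⊕ z))))) refl (z ⁻¹) z a (z ⁻¹) ⟩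
    z ⁻¹ ∙ (z ∙ (a ∙ (z ⁻¹ ∙ z)))     ≡⟨ \\-leftDividesʳ z _ ⟩
    a ∙ (z ⁻¹ ∙ z)                    ≡⟨ cong (a ∙_) (inverseˡ z) ⟩
    a ∙ ε                             ≡⟨ identityʳ a ⟩
    a                                 ∎

  inverse : Subset n → Subset n
  inverse p = subset (λ g → (g ⁻¹) Subset.∈? p)

  ∈-inverse : ∀ {p g} → g ∈ inverse p ⇔ g ⁻¹ ∈ p
  ∈-inverse = mk⇔ (∈-subset⁻ _) (∈-subset⁺ _)

  ∈⁅⁻¹⁆⇔⁻¹∈⁅⁆ : ∀ {v g} → g ∈ ⁅ v ⁻¹ ⁆ ⇔ g ⁻¹ ∈ ⁅ v ⁆
  ∈⁅⁻¹⁆⇔⁻¹∈⁅⁆ {v} {g} = mk⇔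
    (λ g∈ → subst (_∈ ⁅ v ⁆) (sym (trans (cong _⁻¹ (Subset.x∈⁅y⁆⇒x≡y _ g∈)) (⁻¹-involutive v))) (Subset.x∈⁅x⁆ v))
    (λ g⁻¹∈ → subst (_∈ ⁅ v ⁻¹ ⁆) (trans (cong _⁻¹ (sym (Subset.x∈⁅y⁆⇒x≡y _ g⁻¹∈))) (⁻¹-involutive g))
                (Subset.x∈⁅x⁆ (v ⁻¹)))

  ⁅∙⁆-disjoint : ∀ {a b z} → a ≢ b → Disjoint G ⁅ a ∙ z ⁆ ⁅ b ∙ z ⁆
  ⁅∙⁆-disjoint {z = z} a≢b g∈ g∈' =
    a≢b (∙-cancelʳ z _ _ (trans (sym (Subset.x∈⁅y⁆⇒x≡y _ g∈)) (Subset.x∈⁅y⁆⇒x≡y _ g∈')))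

module DoubleCosets (G : FiniteGroup) {H : Subset (FiniteGroup.n G)} (H-subgroup : IsSubgroup G H) where
  open FiniteGroup G
  open FiniteGroupTheory G
  open IsSubgroup H-subgroup
  open ≡-Reasoning
  open import Algebra.Solver.Monoid monoid using (solve; _⊜_; _⊕_)

  inRightCoset-sym : ∀ {y g} → InRightCoset G H y g → InRightCoset G H g y
  inRightCoset-sym {y} (h , h∈H , refl) = h ⁻¹ , ⁻¹-closed h∈H , sym (\\-leftDividesʳ h y)

  inRightCoset-trans : ∀ {w y g} → InRightCoset G H y g → InRightCoset G H w y → InRightCoset G H w g
  inRightCoset-trans {w} (h , h∈H , refl) (h' , h'∈H , refl) = h ∙ h' , ∙-closed h∈H h'∈H , sym (assoc h h' w)

  inRightCoset-shared : ∀ {y t t'} → InRightCoset G H y t → InRightCoset G H y t' → InRightCoset G H t t'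
  inRightCoset-shared t∈Hy t'∈Hy = inRightCoset-trans t'∈Hy (inRightCoset-sym t∈Hy)

  LeftInvariant : (Fin n → Set) → Set
  LeftInvariant K = ∀ {h g} → h ∈ H → K g → K (h ∙ g)

  doubleCoset-leftInvariant : ∀ z → LeftInvariant (InDoubleCoset G H z)
  doubleCoset-leftInvariant z {h} h∈H (a , b , a∈H , b∈H , refl) =
    h ∙ a , b , ∙-closed h∈H a∈H , b∈H ,
    solve 4 (λ h a z b → h ⊕ ((a ⊕ z) ⊕ b) ⊜ ((h ⊕ a) ⊕ z) ⊕ b) refl h a z b

  doubleCoset-⁻¹ : ∀ {z g} → InDoubleCoset G H z g → InDoubleCoset G H (z ⁻¹) (g ⁻¹)
  doubleCoset-⁻¹ {z} (a , b , a∈H , b∈H , refl) =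
    b ⁻¹ , a ⁻¹ , ⁻¹-closed b∈H , ⁻¹-closed a∈H , ⁻¹-anti-homo-∙∙ a z b

  doubleCoset-trans : ∀ {y z g g'} → InDoubleCoset G H y g → InDoubleCoset G H z g →
                      InDoubleCoset G H y g' → InDoubleCoset G H z g'
  doubleCoset-trans {y} {z} (a , b , a∈H , b∈H , refl) (c , d , c∈H , d∈H , yg≡zg) (h , k , h∈H , k∈H , refl) =
    h ∙ a ⁻¹ ∙ c , d ∙ b ⁻¹ ∙ k ,
    ∙-closed (∙-closed h∈H (⁻¹-closed a∈H)) c∈H , ∙-closed (∙-closed d∈H (⁻¹-closed b∈H)) k∈H ,
    (begin
      h ∙ y ∙ k                                ≡⟨ cong (λ u → h ∙ u ∙ k) y≡ ⟩
      h ∙ (a ⁻¹ ∙ (c ∙ z ∙ d) ∙ b ⁻¹) ∙ k      ≡⟨ solve 7 (λ h a⁻ c z d b⁻ k →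
                                                    (h ⊕ ((a⁻ ⊕ ((c ⊕ z) ⊕ d)) ⊕ b⁻)) ⊕ k
                                                    ⊜ (((h ⊕ a⁻) ⊕ c) ⊕ z) ⊕ ((d ⊕ b⁻) ⊕ k))
                                                  refl h (a ⁻¹) c z d (b ⁻¹) k ⟩
      h ∙ a ⁻¹ ∙ c ∙ z ∙ (d ∙ b ⁻¹ ∙ k)        ∎)
    where
    y≡ : y ≡ a ⁻¹ ∙ (c ∙ z ∙ d) ∙ b ⁻¹
    y≡ = begin
      y                          ≡⟨ //-rightDividesʳ b y ⟨
      y ∙ b ∙ b ⁻¹               ≡⟨ cong (_∙ b ⁻¹) (\\-leftDividesʳ a (y ∙ b)) ⟨
      a ⁻¹ ∙ (a ∙ (y ∙ b)) ∙ b ⁻¹ ≡⟨ cong (λ u → a ⁻¹ ∙ u ∙ b ⁻¹) (trans (sym (assoc a y b)) yg≡zg) ⟩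
      a ⁻¹ ∙ (c ∙ z ∙ d) ∙ b ⁻¹  ∎

  doubleCosets-meet⇒equal : ∀ {y z g} → InDoubleCoset G H y g → InDoubleCoset G H z g →
                            ∀ g' → InDoubleCoset G H y g' ⇔ InDoubleCoset G H z g'
  doubleCosets-meet⇒equal g∈HyH g∈HzH g' = mk⇔ (doubleCoset-trans g∈HyH g∈HzH) (doubleCoset-trans g∈HzH g∈HyH)

  ∪-isRightTransversal : ∀ {K₁ K₂ : Fin n → Set} {S T} → LeftInvariant K₁ → (∀ {g} → K₁ g → ¬ K₂ g) →
    IsRightTransversal G H K₁ S → IsRightTransversal G H K₂ T →
    IsRightTransversal G H (λ g → K₁ g ⊎ K₂ g) (S ∪ T)
  ∪-isRightTransversal {K₁} {K₂} {S} {T} K₁-inv K₁∩K₂=∅ S-tr T-tr = record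
    { ⊆K     = λ t∈S∪T → Sum.map (S.⊆K) (T.⊆K) (Subset.x∈p∪q⁻ S T t∈S∪T)
    ; exists = exists
    ; unique = unique
    }
    where
    module S = IsRightTransversal S-tr
    module T = IsRightTransversal T-tr

    exists : ∀ y → K₁ y ⊎ K₂ y → ∃ λ t → t ∈ S ∪ T × InRightCoset G H y t
    exists y (inj₁ y∈K₁) with S.exists y y∈K₁
    ... | t , t∈S , t∈Hy = t , Subset.x∈p∪q⁺ (inj₁ t∈S) , t∈Hy
    exists y (inj₂ y∈K₂) with T.exists y y∈K₂
    ... | t , t∈T , t∈Hy = t , Subset.x∈p∪q⁺ (inj₂ t∈T) , t∈Hy

    apart : ∀ {t t'} → t ∈ S → t' ∈ T → ¬ InRightCoset G H t t'
    apart t∈S t'∈T (h , h∈H , refl) = K₁∩K₂=∅ (K₁-inv h∈H (S.⊆K t∈S)) (T.⊆K t'∈T)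

    unique : ∀ y {t t'} → t ∈ S ∪ T → t' ∈ S ∪ T → InRightCoset G H y t → InRightCoset G H y t' → t ≡ t'
    unique y {t} {t'} t∈ t'∈ t∈Hy t'∈Hy
      with Subset.x∈p∪q⁻ S T t∈ | Subset.x∈p∪q⁻ S T t'∈
    ... | inj₁ t∈S | inj₁ t'∈S = S.unique y t∈S t'∈S t∈Hy t'∈Hy
    ... | inj₂ t∈T | inj₂ t'∈T = T.unique y t∈T t'∈T t∈Hy t'∈Hy
    ... | inj₁ t∈S | inj₂ t'∈T = ⊥-elim (apart t∈S t'∈T (inRightCoset-shared t∈Hy t'∈Hy))
    ... | inj₂ t∈T | inj₁ t'∈S = ⊥-elim (apart t'∈S t∈T (inRightCoset-shared t'∈Hy t∈Hy))

  TrivialMeet : Fin n → Set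
  TrivialMeet z = ∀ {h} → h ∈ H → h ^ z ∈ H → h ≡ ε

  Normalises : Fin n → Set
  Normalises z = ∀ {h} → h ∈ H → h ^ z ∈ H

  meet : Fin n → Subset n
  meet z = subset (λ h → h Subset.∈? H ×-dec (h ^ z) Subset.∈? H)

  meet-isSubgroup : ∀ z → IsSubgroup G (meet z)
  meet-isSubgroup z = record
    { ε∈        = ∈-subset⁺ _ (ε∈ , subst (_∈ H) (sym (^-ε z)) ε∈)
    ; ∙-closed  = λ a∈ b∈ → closed₂ (∈-subset⁻ _ a∈) (∈-subset⁻ _ b∈)
    ; ⁻¹-closed = λ a∈ → closed₁ (∈-subset⁻ _ a∈)
    }
    where
    closed₂ : ∀ {a b} → a ∈ H × a ^ z ∈ H → b ∈ H × b ^ z ∈ H → a ∙ b ∈ meet z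
    closed₂ (a∈H , aᶻ∈H) (b∈H , bᶻ∈H) =
      ∈-subset⁺ _ (∙-closed a∈H b∈H , subst (_∈ H) (sym (^-∙ _ _ z)) (∙-closed aᶻ∈H bᶻ∈H))
    closed₁ : ∀ {a} → a ∈ H × a ^ z ∈ H → a ⁻¹ ∈ meet z
    closed₁ (a∈H , aᶻ∈H) = ∈-subset⁺ _ (⁻¹-closed a∈H , subst (_∈ H) (sym (^-⁻¹ _ z)) (⁻¹-closed aᶻ∈H))

  trivialMeet-⁻¹ : ∀ {z} → TrivialMeet z → TrivialMeet (z ⁻¹)
  trivialMeet-⁻¹ {z} trivial {h} h∈H hᶻ⁻¹∈H = begin
    h                 ≡⟨ ^-⁻¹-cancel h z ⟨
    (h ^ (z ⁻¹)) ^ z  ≡⟨ cong (_^ z) (trivial hᶻ⁻¹∈H (subst (_∈ H) (sym (^-⁻¹-cancel h z)) h∈H)) ⟩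
    ε ^ z             ≡⟨ ^-ε z ⟩
    ε                 ∎

  trivialMeet⊎normalises : Prime ∣ H ∣ → ∀ z → TrivialMeet z ⊎ Normalises z
  trivialMeet⊎normalises p z
    with Fin.any? (λ h → h Subset.∈? meet z ×-dec ¬? (h ≟ ε))
  ... | yes (y , y∈meet , y≢ε) = inj₂ λ h∈H → proj₂ (∈-subset⁻ _
    (nontrivial-subgroup-of-prime-order (meet-isSubgroup z) H-subgroup p
      (λ h∈meet → proj₁ (∈-subset⁻ _ h∈meet)) y∈meet y≢ε h∈H))
  ... | no ∄y = inj₁ λ {h} h∈H hᶻ∈H → decidable-stable (h ≟ ε)
    λ h≢ε → ∄y (h , ∈-subset⁺ _ (h∈H , hᶻ∈H) , h≢ε)

  trivialMeet⊎normalises± : Prime ∣ H ∣ → ∀ z → TrivialMeet z ⊎ (Normalises z × Normalises (z ⁻¹))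
  trivialMeet⊎normalises± p z with trivialMeet⊎normalises p z | trivialMeet⊎normalises p (z ⁻¹)
  ... | inj₁ trivial | _              = inj₁ trivial
  ... | inj₂ _       | inj₁ trivial⁻¹ = inj₁ (subst TrivialMeet (⁻¹-involutive z) (trivialMeet-⁻¹ trivial⁻¹))
  ... | inj₂ normal  | inj₂ normal⁻¹  = inj₂ (normal , normal⁻¹)

  doubleCoset-unique : ∀ {z a b c d} → TrivialMeet z → a ∈ H → b ∈ H → c ∈ H → d ∈ H →
                       a ∙ z ∙ b ≡ c ∙ z ∙ d → a ≡ c × b ≡ d
  doubleCoset-unique {z} {a} {b} {c} {d} trivial a∈H b∈H c∈H d∈H azb≡czd = a≡c , b≡d
    where
    c⁻¹a∈H : c ⁻¹ ∙ a ∈ H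
    c⁻¹a∈H = ∙-closed (⁻¹-closed c∈H) a∈H

    [c⁻¹a]ᶻ≡db⁻¹ : (c ⁻¹ ∙ a) ^ z ≡ d ∙ b ⁻¹
    [c⁻¹a]ᶻ≡db⁻¹ = begin
      z ⁻¹ ∙ (c ⁻¹ ∙ a) ∙ z                ≡⟨ //-rightDividesʳ b _ ⟨
      z ⁻¹ ∙ (c ⁻¹ ∙ a) ∙ z ∙ b ∙ b ⁻¹     ≡⟨ cong (_∙ b ⁻¹) (solve 5 (λ z⁻ c⁻ a z b →
                                                 (((z⁻ ⊕ (c⁻ ⊕ a)) ⊕ z) ⊕ b) ⊜ (z⁻ ⊕ (c⁻ ⊕ ((a ⊕ z) ⊕ b))))
                                               refl (z ⁻¹) (c ⁻¹) a z b) ⟩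
      z ⁻¹ ∙ (c ⁻¹ ∙ (a ∙ z ∙ b)) ∙ b ⁻¹   ≡⟨ cong (λ u → z ⁻¹ ∙ (c ⁻¹ ∙ u) ∙ b ⁻¹) azb≡czd ⟩
      z ⁻¹ ∙ (c ⁻¹ ∙ (c ∙ z ∙ d)) ∙ b ⁻¹   ≡⟨ cong (λ u → z ⁻¹ ∙ u ∙ b ⁻¹)
                                               (trans (cong (c ⁻¹ ∙_) (assoc c z d)) (\\-leftDividesʳ c _)) ⟩
      z ⁻¹ ∙ (z ∙ d) ∙ b ⁻¹                ≡⟨ cong (_∙ b ⁻¹) (\\-leftDividesʳ z d) ⟩
      d ∙ b ⁻¹                             ∎

    a≡c : a ≡ c
    a≡c = begin
      a                 ≡⟨ \\-leftDividesˡ c a ⟨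
      c ∙ (c ⁻¹ ∙ a)    ≡⟨ cong (c ∙_) (trivial c⁻¹a∈H
                             (subst (_∈ H) (sym [c⁻¹a]ᶻ≡db⁻¹) (∙-closed d∈H (⁻¹-closed b∈H)))) ⟩
      c ∙ ε             ≡⟨ identityʳ c ⟩
      c                 ∎

    b≡d : b ≡ d
    b≡d = ∙-cancelˡ (c ∙ z) b d (trans (cong (λ u → u ∙ z ∙ b) (sym a≡c)) azb≡czd)

  doubleCoset⊆rightCoset : ∀ {z y} → Normalises (z ⁻¹) → InDoubleCoset G H z y → InRightCoset G H z y
  doubleCoset⊆rightCoset {z} normal (a , b , a∈H , b∈H , refl) =
    a ∙ b ^ (z ⁻¹) , ∙-closed a∈H (normal b∈H) , (begin
      a ∙ z ∙ b                          ≡⟨ assoc a z b ⟩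
      a ∙ (z ∙ b)                        ≡⟨ cong (a ∙_) (//-rightDividesˡ z (z ∙ b)) ⟨
      a ∙ (z ∙ b ∙ z ⁻¹ ∙ z)             ≡⟨ cong (λ u → a ∙ (u ∙ b ∙ z ⁻¹ ∙ z)) (⁻¹-involutive z) ⟨
      a ∙ (z ⁻¹ ⁻¹ ∙ b ∙ z ⁻¹ ∙ z)       ≡⟨ assoc a _ z ⟨
      a ∙ b ^ (z ⁻¹) ∙ z                 ∎)

  InverseClosedTransversals : (Fin n → Set) → ℕ → Set
  InverseClosedTransversals K m = ∃ λ (T : Fin m → Subset n) →
    PairwiseDisjoint G T × (∀ i → IsRightTransversal G H K (T i) × InverseClosed G (T i))

  TransversalsWithInverseClosedUnion : (Fin n → Set) → ℕ → Set
  TransversalsWithInverseClosedUnion K b = ∃ λ (T : Fin b → Subset n) →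
    PairwiseDisjoint G T × (∀ i → IsRightTransversal G H K (T i)) × UnionInverseClosed G T

  take-transversals : ∀ {K m b} → b ≤ m → InverseClosedTransversals K m → TransversalsWithInverseClosedUnion K b
  take-transversals b≤m (T , T-disjoint , T-transversal) =
    (λ i → T (inject≤ i b≤m)) ,
    (λ i j i≢j → T-disjoint _ _ (λ eq → i≢j (Fin.inject≤-injective b≤m b≤m i j eq))) ,
    (λ i → proj₁ (T-transversal _)) ,
    (λ i g∈T → i , proj₂ (T-transversal _) g∈T)

  module _ {x : Fin n} (HxH≢Hx⁻¹H : ¬ (∀ g → InDoubleCoset G H x g ⇔ InDoubleCoset G H (x ⁻¹) g)) where

    HxH∪Hx⁻¹H : Fin n → Set
    HxH∪Hx⁻¹H g = InDoubleCoset G H x g ⊎ InDoubleCoset G H (x ⁻¹) g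

    HxH∩Hx⁻¹H≡∅ : ∀ {g} → InDoubleCoset G H x g → ¬ InDoubleCoset G H (x ⁻¹) g
    HxH∩Hx⁻¹H≡∅ g∈HxH g∈Hx⁻¹H = HxH≢Hx⁻¹H (doubleCosets-meet⇒equal g∈HxH g∈Hx⁻¹H)

    inverseClosedTransversals : (V W : Fin n → Subset n) →
      (∀ {a} → a ∈ H → IsRightTransversal G H (InDoubleCoset G H x) (V a)) →
      (∀ {a} → a ∈ H → IsRightTransversal G H (InDoubleCoset G H (x ⁻¹)) (W a)) →
      (∀ {a g} → g ∈ W a ⇔ g ⁻¹ ∈ V a) →
      (∀ {a b} → a ∈ H → b ∈ H → a ≢ b → Disjoint G (V a) (V b)) →
      InverseClosedTransversals HxH∪Hx⁻¹H ∣ H ∣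
    inverseClosedTransversals V W V-transversal W-transversal W≡V⁻¹ V-disjoint =
      (λ i → T (enumerate H i)) ,
      (λ i j i≢j → T-disjoint (enumerate-∈ H i) (enumerate-∈ H j) (λ eq → i≢j (enumerate-injective H eq))) ,
      (λ i → T-transversal (enumerate-∈ H i) , T-inverseClosed)
      where
      T : Fin n → Subset n
      T a = V a ∪ W a

      open Equivalence

      T-transversal : ∀ {a} → a ∈ H → IsRightTransversal G H HxH∪Hx⁻¹H (T a)
      T-transversal a∈H = ∪-isRightTransversal (doubleCoset-leftInvariant x) HxH∩Hx⁻¹H≡∅
                            (V-transversal a∈H) (W-transversal a∈H)

      T-inverseClosed : ∀ {a} → InverseClosed G (T a)
      T-inverseClosed {a} {g} g∈T with Subset.x∈p∪q⁻ (V a) (W a) g∈T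
      ... | inj₁ g∈V = Subset.x∈p∪q⁺ (inj₂ (from W≡V⁻¹ (subst (_∈ V a) (sym (⁻¹-involutive g)) g∈V)))
      ... | inj₂ g∈W = Subset.x∈p∪q⁺ (inj₁ (to W≡V⁻¹ g∈W))

      T-disjoint : ∀ {a b} → a ∈ H → b ∈ H → a ≢ b → Disjoint G (T a) (T b)
      T-disjoint {a} {b} a∈H b∈H a≢b g∈Ta g∈Tb
        with Subset.x∈p∪q⁻ (V a) (W a) g∈Ta | Subset.x∈p∪q⁻ (V b) (W b) g∈Tb
      ... | inj₁ g∈Va | inj₁ g∈Vb = V-disjoint a∈H b∈H a≢b g∈Va g∈Vb
      ... | inj₂ g∈Wa | inj₂ g∈Wb = V-disjoint a∈H b∈H a≢b (to W≡V⁻¹ g∈Wa) (to W≡V⁻¹ g∈Wb)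
      ... | inj₁ g∈Va | inj₂ g∈Wb = HxH∩Hx⁻¹H≡∅ (IsRightTransversal.⊆K (V-transversal a∈H) g∈Va)
                                                (IsRightTransversal.⊆K (W-transversal b∈H) g∈Wb)
      ... | inj₂ g∈Wa | inj₁ g∈Vb = HxH∩Hx⁻¹H≡∅ (IsRightTransversal.⊆K (V-transversal b∈H) g∈Vb)
                                                (IsRightTransversal.⊆K (W-transversal a∈H) g∈Wa)

  singleton-isRightTransversal : ∀ {z v} → Normalises (z ⁻¹) → InDoubleCoset G H z v →
                                 IsRightTransversal G H (InDoubleCoset G H z) ⁅ v ⁆
  singleton-isRightTransversal {z} {v} normal v∈HzH = record
    { ⊆K     = λ t∈⁅v⁆ → subst (InDoubleCoset G H z) (sym (Subset.x∈⁅y⁆⇒x≡y v t∈⁅v⁆)) v∈HzH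
    ; exists = λ y y∈HzH → v , Subset.x∈⁅x⁆ v ,
                 inRightCoset-shared (doubleCoset⊆rightCoset normal y∈HzH) (doubleCoset⊆rightCoset normal v∈HzH)
    ; unique = λ _ t∈⁅v⁆ t'∈⁅v⁆ _ _ → trans (Subset.x∈⁅y⁆⇒x≡y v t∈⁅v⁆) (sym (Subset.x∈⁅y⁆⇒x≡y v t'∈⁅v⁆))
    }

  ∙z∈HzH : ∀ {a z} → a ∈ H → InDoubleCoset G H z (a ∙ z)
  ∙z∈HzH a∈H = _ , ε , a∈H , ε∈ , sym (identityʳ _)

  ⁅∙⁆-isRightTransversal : ∀ {a z} → Normalises (z ⁻¹) → a ∈ H →
                           IsRightTransversal G H (InDoubleCoset G H z) ⁅ a ∙ z ⁆
  ⁅∙⁆-isRightTransversal normal⁻¹ a∈H = singleton-isRightTransversal normal⁻¹ (∙z∈HzH a∈H)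

  ⁅∙⁆⁻¹-isRightTransversal : ∀ {a z} → Normalises z → a ∈ H →
                             IsRightTransversal G H (InDoubleCoset G H (z ⁻¹)) ⁅ (a ∙ z) ⁻¹ ⁆
  ⁅∙⁆⁻¹-isRightTransversal {z = z} normal a∈H = singleton-isRightTransversal
    (subst Normalises (sym (⁻¹-involutive z)) normal) (doubleCoset-⁻¹ (∙z∈HzH a∈H))

  module _ {x : Fin n} (trivial : TrivialMeet x) where

    diagonal : Fin n → Subset n
    diagonal a = subset (λ g → Fin.any? (λ k → k Subset.∈? H ×-dec g ≟ a ∙ k ∙ x ∙ k))

    diagonal-isRightTransversal : ∀ {a} → a ∈ H → IsRightTransversal G H (InDoubleCoset G H x) (diagonal a)
    diagonal-isRightTransversal {a} a∈H = record { ⊆K = ⊆HxH ; exists = exists ; unique = unique }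
      where
      ⊆HxH : ∀ {t} → t ∈ diagonal a → InDoubleCoset G H x t
      ⊆HxH t∈ with ∈-subset⁻ _ t∈
      ... | k , k∈H , refl = a ∙ k , k , ∙-closed a∈H k∈H , k∈H , refl

      exists : ∀ y → InDoubleCoset G H x y → ∃ λ t → t ∈ diagonal a × InRightCoset G H y t
      exists y (h , k , h∈H , k∈H , refl) = a ∙ k ∙ x ∙ k , ∈-subset⁺ _ (k , k∈H , refl) ,
        inRightCoset-shared (h , h∈H , assoc h x k) (a ∙ k , ∙-closed a∈H k∈H , assoc (a ∙ k) x k)

      unique : ∀ y {t t'} → t ∈ diagonal a → t' ∈ diagonal a →
               InRightCoset G H y t → InRightCoset G H y t' → t ≡ t'
      unique y t∈ t'∈ t∈Hy t'∈Hy with ∈-subset⁻ _ t∈ | ∈-subset⁻ _ t'∈ | inRightCoset-shared t∈Hy t'∈Hy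
      ... | k , k∈H , refl | k' , k'∈H , refl | h , h∈H , t'≡ht =
        cong (λ k → a ∙ k ∙ x ∙ k) (sym (proj₂ (doubleCoset-unique trivial
          (∙-closed a∈H k'∈H) k'∈H (∙-closed h∈H (∙-closed a∈H k∈H)) k∈H
          (trans t'≡ht (trans (sym (assoc h _ k)) (cong (_∙ k) (sym (assoc h (a ∙ k) x))))))))

    diagonal⁻¹-isRightTransversal : ∀ {a} → a ∈ H →
      IsRightTransversal G H (InDoubleCoset G H (x ⁻¹)) (inverse (diagonal a))
    diagonal⁻¹-isRightTransversal {a} a∈H = record { ⊆K = ⊆Hx⁻¹H ; exists = exists ; unique = unique }
      where
      ⊆Hx⁻¹H : ∀ {t} → t ∈ inverse (diagonal a) → InDoubleCoset G H (x ⁻¹) t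
      ⊆Hx⁻¹H {t} t∈ = subst (InDoubleCoset G H (x ⁻¹)) (⁻¹-involutive t)
        (doubleCoset-⁻¹ (IsRightTransversal.⊆K (diagonal-isRightTransversal a∈H) (∈-subset⁻ _ t∈)))

      exists : ∀ y → InDoubleCoset G H (x ⁻¹) y → ∃ λ t → t ∈ inverse (diagonal a) × InRightCoset G H y t
      exists y (h , k , h∈H , k∈H , refl) =
        (a ∙ k₀ ∙ x ∙ k₀) ⁻¹ , ∈-subset⁺ _ (∈-subset⁺ _ (k₀ , k₀∈H , ⁻¹-involutive _)) ,
        inRightCoset-shared (h , h∈H , assoc h (x ⁻¹) k) (k₀ ⁻¹ , ⁻¹-closed k₀∈H , t≡)
        where
        k₀ : Fin n
        k₀ = a ⁻¹ ∙ k ⁻¹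
        k₀∈H : k₀ ∈ H
        k₀∈H = ∙-closed (⁻¹-closed a∈H) (⁻¹-closed k∈H)
        t≡ : (a ∙ k₀ ∙ x ∙ k₀) ⁻¹ ≡ k₀ ⁻¹ ∙ (x ⁻¹ ∙ k)
        t≡ = begin
          (a ∙ k₀ ∙ x ∙ k₀) ⁻¹        ≡⟨ ⁻¹-anti-homo-∙∙ (a ∙ k₀) x k₀ ⟩
          k₀ ⁻¹ ∙ x ⁻¹ ∙ (a ∙ k₀) ⁻¹  ≡⟨ cong (λ u → k₀ ⁻¹ ∙ x ⁻¹ ∙ u ⁻¹) (\\-leftDividesˡ a (k ⁻¹)) ⟩
          k₀ ⁻¹ ∙ x ⁻¹ ∙ k ⁻¹ ⁻¹      ≡⟨ cong (k₀ ⁻¹ ∙ x ⁻¹ ∙_) (⁻¹-involutive k) ⟩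
          k₀ ⁻¹ ∙ x ⁻¹ ∙ k            ≡⟨ assoc _ _ _ ⟩
          k₀ ⁻¹ ∙ (x ⁻¹ ∙ k)          ∎

      unique : ∀ y {t t'} → t ∈ inverse (diagonal a) → t' ∈ inverse (diagonal a) →
               InRightCoset G H y t → InRightCoset G H y t' → t ≡ t'
      unique y {t} {t'} t∈ t'∈ t∈Hy t'∈Hy
        with ∈-subset⁻ _ (∈-subset⁻ _ t∈) | ∈-subset⁻ _ (∈-subset⁻ _ t'∈) | inRightCoset-shared t∈Hy t'∈Hy
      ... | k , k∈H , t⁻¹≡ | k' , k'∈H , t'⁻¹≡ | h , h∈H , refl =
        ⁻¹-injective (trans t⁻¹≡ (trans (cong (λ k → a ∙ k ∙ x ∙ k) (sym k'≡k)) (sym t'⁻¹≡)))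
        where
        t'⁻¹≡akxkh⁻¹ : a ∙ k' ∙ x ∙ k' ≡ a ∙ k ∙ x ∙ (k ∙ h ⁻¹)
        t'⁻¹≡akxkh⁻¹ = begin
          a ∙ k' ∙ x ∙ k'          ≡⟨ t'⁻¹≡ ⟨
          (h ∙ t) ⁻¹               ≡⟨ ⁻¹-anti-homo-∙ h t ⟩
          t ⁻¹ ∙ h ⁻¹              ≡⟨ cong (_∙ h ⁻¹) t⁻¹≡ ⟩
          a ∙ k ∙ x ∙ k ∙ h ⁻¹     ≡⟨ assoc _ k (h ⁻¹) ⟩
          a ∙ k ∙ x ∙ (k ∙ h ⁻¹)   ∎
        k'≡k : k' ≡ k
        k'≡k = ∙-cancelˡ a k' k (proj₁ (doubleCoset-unique trivial (∙-closed a∈H k'∈H) k'∈H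
                 (∙-closed a∈H k∈H) (∙-closed k∈H (⁻¹-closed h∈H)) t'⁻¹≡akxkh⁻¹))

    diagonal-disjoint : ∀ {a b} → a ∈ H → b ∈ H → a ≢ b → Disjoint G (diagonal a) (diagonal b)
    diagonal-disjoint a∈H b∈H a≢b g∈ g∈' with ∈-subset⁻ _ g∈ | ∈-subset⁻ _ g∈'
    ... | k , k∈H , refl | k' , k'∈H , akxk≡bk'xk' with doubleCoset-unique trivial
          (∙-closed a∈H k∈H) k∈H (∙-closed b∈H k'∈H) k'∈H akxk≡bk'xk'
    ... | ak≡bk' , refl = a≢b (∙-cancelʳ k _ _ ak≡bk')

lemma3p3 : (G : FiniteGroup) → let open FiniteGroup G in
  (H : Subset n) → IsSubgroup G H → Prime ∣ H ∣ →
  (x : Fin n) →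
  ¬ (∀ g → InDoubleCoset G H x g ⇔ InDoubleCoset G H (x ⁻¹) g) →
  (∃ λ (T : Fin ∣ H ∣ → Subset n) →
      PairwiseDisjoint G T ×
      (∀ i → IsRightTransversal G H
               (λ g → InDoubleCoset G H x g ⊎ InDoubleCoset G H (x ⁻¹) g) (T i)
             × InverseClosed G (T i)))
  ×
  (∀ (b : ℕ) → b ≤ ∣ H ∣ →
    ∃ λ (T : Fin b → Subset n) →
      PairwiseDisjoint G T ×
      (∀ i → IsRightTransversal G H
               (λ g → InDoubleCoset G H x g ⊎ InDoubleCoset G H (x ⁻¹) g) (T i))
      × UnionInverseClosed G T)
lemma3p3 G H H-subgroup ∣H∣-prime x HxH≢Hx⁻¹H = transversals , λ b b≤∣H∣ → take-transversals b≤∣H∣ transversals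
  where
  open FiniteGroup G
  open FiniteGroupTheory G
  open DoubleCosets G H-subgroup

  transversals : InverseClosedTransversals (λ g → InDoubleCoset G H x g ⊎ InDoubleCoset G H (x ⁻¹) g) ∣ H ∣
  transversals with trivialMeet⊎normalises± ∣H∣-prime x
  ... | inj₁ trivial = inverseClosedTransversals HxH≢Hx⁻¹H
    (diagonal trivial) (λ a → inverse (diagonal trivial a))
    (diagonal-isRightTransversal trivial) (diagonal⁻¹-isRightTransversal trivial)
    ∈-inverse (diagonal-disjoint trivial)
  ... | inj₂ (normal , normal⁻¹) = inverseClosedTransversals HxH≢Hx⁻¹H
    (λ a → ⁅ a ∙ x ⁆) (λ a → ⁅ (a ∙ x) ⁻¹ ⁆)
    (⁅∙⁆-isRightTransversal normal⁻¹) (⁅∙⁆⁻¹-isRightTransversal normal)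
    ∈⁅⁻¹⁆⇔⁻¹∈⁅⁆ (λ _ _ → ⁅∙⁆-disjoint)
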